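{- Let $\lambda\in\mathbf{k}$. The twisted algebra $\mathrm{ADF}\otimes\mathrm{ADF}$ is a Rota–Baxter species of weight $\lambda$ with the operator $R^{(2)}$ defined, for every finite set $X$, every $X_1\subseteq X$ and $F\otimes G\in\mathrm{ADF}[X_1]\otimes\mathrm{ADF}[X\setminus X_1]$, by $R^{(2)}_X(F\otimes G)=R_{X_1}(F)\otimes G+\epsilon_{X_1}(F)\bullet\otimes R_{X\setminus X_1}(G)$.
   Context: $\mathbf{k}$ is a field of characteristic zero. Species: functors from finite sets with bijections to $\mathbf{k}$-vector spaces. Cauchy product: $(P\otimes Q)[X]=\bigoplus_{X_1\sqcup X_2=X}P[X_1]\otimes Q[X_2]$. A twisted algebra is a species with natural, associative, unital products $m_{X,Y}:P[X]\otimes P[Y]\to P[X\sqcup Y]$. A Rota–Baxter species of weight $\lambda$ is a twisted algebra with a morphism of species $R$ such that $m_{X,Y}(R_Xx\otimes R_Yy)=R_{X\sqcup Y}m_{X,Y}(R_Xx\otimes y+x\otimes R_Yy+\lambda x\otimes y)$ for all $x\in P[X]$, $y\in P[Y]$. For a finite set $X$, $\mathrm{ADF}[X]$ has basis the planar rooted forests with exactly $|X|$ angles (gaps between consecutive leaves left to right, inside a tree or between adjacent trees) decorated bijectively by $X$; forests are written $T_1x_1\cdots x_mT_{m+1}$; $\bullet$ is the one-vertex tree; $\mathrm{ADF}[\sigma]$ relabels decorations. $R_X=B^+$ adds a new root joined to all roots. The product $\diamond$ (weight $\lambda$) is defined bilinearly by induction on depth: for trees $\bullet\diamond T'=T'$,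 $T\diamond\bullet=T$, $B^+(A)\diamond B^+(A')=B^+(B^+(A)\diamond A')+B^+(A\diamond B^+(A'))+\lambda B^+(A\diamond A')$; for forests $F=T_1x_1\cdots x_mT_{m+1}$, $G=T'_1y_1\cdots y_nT'_{n+1}$, $F\diamond G=T_1x_1\cdots x_m(T_{m+1}\diamond T'_1)y_1\cdots y_nT'_{n+1}$. $\mathrm{ADF}$ is a twisted algebra with $m_{X,Y}(F\otimes G)=F\diamond G$ and unit $\bullet$. The twisted algebra $\mathrm{ADF}\otimes\mathrm{ADF}$ has product $(F_1\otimes G_1)\cdot(F_2\otimes G_2)=(F_1\diamond F_2)\otimes(G_1\diamond G_2)$ for $F_1\otimes G_1\in\mathrm{ADF}[X_1]\otimes\mathrm{ADF}[X\setminus X_1]$, $F_2\otimes G_2\in\mathrm{ADF}[Y_1]\otimes\mathrm{ADF}[Y\setminus Y_1]$ (landing in $\mathrm{ADF}[X_1\sqcup Y_1]\otimes\mathrm{ADF}[(X\setminus X_1)\sqcup(Y\setminus Y_1)]$), unit $\bullet\otimes\bullet$. The maps $\epsilon_X:\mathrm{ADF}[X]\to\mathbf{k}$ are $\epsilon_\emptyset(\bullet)=1$ and $\epsilon_X(F)=0$ for every other basis forest; $\epsilon_{X_1}(F)\bullet$ is thus zero unless $X_1=\emptyset$, in which case it lies in $\mathrm{ADF}[\emptyset]$. -}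

module Defs where

import Level
open import Level using (Level; _⊔_) renaming (suc to lsuc)
open import Data.Nat using (ℕ; zero; suc)
open import Data.Fin using (Fin)
import Data.Fin.Properties as FinP
open import Data.Product using (_×_; _,_; ∃; proj₁; proj₂)
open import Data.Sum using (_⊎_; inj₁; inj₂)
import Data.Sum.Properties as SumP
open import Data.List using (List; []; _∷_; _++_; map; concatMap)
open import Data.List.Membership.Propositional using (_∈_)
open import Data.List.Relation.Unary.Unique.Propositional using (Unique)
open import Data.List.Relation.Unary.All using (All)
open import Relation.Nullary using (¬_; Dec; yes; no)
open import Relation.Nullary.Decidable using (via-injection)
open import Relation.Binary.Definitions using (DecidableEquality)
open import Relation.Binary.PropositionalEquality using (_≡_; refl; cong; cong₂)
open import Function.Bundles using (_↔_; Inverse)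
open import Function.Properties.Inverse using (↔⇒↣)
open import Algebra.Bundles using (CommutativeRing)

record Field (c ℓ : Level) : Set (lsuc (c ⊔ ℓ)) where
  field
    commutativeRing : CommutativeRing c ℓ
  open CommutativeRing commutativeRing public
  field
    0≉1     : ¬ (0# ≈ 1#)
    inverse : ∀ x → ¬ (x ≈ 0#) → ∃ λ y → (x * y) ≈ 1#

natCast : ∀ {c ℓ} (K : Field c ℓ) → ℕ → Field.Carrier K
natCast K zero    = Field.0# K
natCast K (suc n) = Field._+_ K (Field.1# K) (natCast K n)

CharZero : ∀ {c ℓ} → Field c ℓ → Set ℓ
CharZero K = ∀ n → Field._≈_ K (natCast K n) (Field.0# K) → n ≡ 0

record FinSet : Set₁ where
  field
    Carrier : Set
    size    : ℕ
    enum    : Carrier ↔ Fin size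

  _≟_ : DecidableEquality Carrier
  _≟_ = via-injection (↔⇒↣ enum) FinP._≟_

-- Planar rooted trees / forests whose angles carry labels in L.
-- A forest T₁ x₁ T₂ … x_m T_{m+1} is  T₁ ⟨ x₁ ⟩ (T₂ ⟨ x₂ ⟩ … ⟦ T_{m+1} ⟧).
-- The angles of B⁺ F are exactly the angles of F; • has no angle.

data Tree (L : Set) : Set
data Forest (L : Set) : Set

data Tree L where
  •  : Tree L
  B⁺ : Forest L → Tree L

data Forest L where
  ⟦_⟧   : Tree L → Forest L
  _⟨_⟩_ : Tree L → L → Forest L → Forest L

infixr 5 _⟨_⟩_

labelsT : ∀ {L} → Tree L → List L
labelsF : ∀ {L} → Forest L → List L
labelsT •      = []
labelsT (B⁺ F) = labelsF F
labelsF ⟦ T ⟧         = labelsT T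
labelsF (T ⟨ x ⟩ F) = labelsT T ++ (x ∷ labelsF F)

relabelT : ∀ {L M} → (L → M) → Tree L → Tree M
relabelF : ∀ {L M} → (L → M) → Forest L → Forest M
relabelT f •      = •
relabelT f (B⁺ F) = B⁺ (relabelF f F)
relabelF f ⟦ T ⟧       = ⟦ relabelT f T ⟧
relabelF f (T ⟨ x ⟩ F) = relabelT f T ⟨ f x ⟩ relabelF f F

module _ {L : Set} (_≟L_ : DecidableEquality L) where
  decT : DecidableEquality (Tree L)
  decF : DecidableEquality (Forest L)
  decT • • = yes refl
  decT • (B⁺ _) = no λ ()
  decT (B⁺ _) • = no λ ()
  decT (B⁺ F) (B⁺ G) with decF F G
  ... | yes refl = yes refl
  ... | no ne = no λ { refl → ne refl }
  decF ⟦ T ⟧ ⟦ U ⟧ with decT T U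
  ... | yes refl = yes refl
  ... | no ne = no λ { refl → ne refl }
  decF ⟦ _ ⟧ (_ ⟨ _ ⟩ _) = no λ ()
  decF (_ ⟨ _ ⟩ _) ⟦ _ ⟧ = no λ ()
  decF (T ⟨ x ⟩ F) (U ⟨ y ⟩ G) with decT T U | x ≟L y | decF F G
  ... | yes refl | yes refl | yes refl = yes refl
  ... | no ne | _ | _ = no λ { refl → ne refl }
  ... | yes _ | no ne | _ = no λ { refl → ne refl }
  ... | yes _ | yes _ | no ne = no λ { refl → ne refl }

  decP : DecidableEquality (Forest L × Forest L)
  decP (F , G) (F' , G') with decF F F' | decF G G'
  ... | yes refl | yes refl = yes refl
  ... | no ne | _ = no λ { refl → ne refl }
  ... | yes _ | no ne = no λ { refl → ne refl }

BijDecorated : (X : FinSet) → Forest (FinSet.Carrier X) → Set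
BijDecorated X F = Unique (labelsF F) × (∀ x → x ∈ labelsF F)

-- F ⊗ G is a basis element of ADF[X₁] ⊗ ADF[X ∖ X₁] for some X₁ ⊆ X
-- (namely X₁ = decorations of F): decorations of F and G together are
-- a bijective decoration by X.
ValidPair : (X : FinSet) → Forest (FinSet.Carrier X) × Forest (FinSet.Carrier X) → Set
ValidPair X (F , G) = Unique (labelsF F ++ labelsF G) × (∀ x → x ∈ (labelsF F ++ labelsF G))

module WithField {c ℓ} (K : Field c ℓ) (w : Field.Carrier K) where
  open Field K

  LC : Set → Set c
  LC A = List (Carrier × A)

  coeff : ∀ {A} → DecidableEquality A → LC A → A → Carrier
  coeff _≟A_ [] b = 0#
  coeff _≟A_ ((k , a) ∷ v) b with a ≟A b
  ... | yes _ = k + coeff _≟A_ v b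
  ... | no _  = coeff _≟A_ v b

  EqV : ∀ {A} → DecidableEquality A → LC A → LC A → Set ℓ
  EqV d v v' = ∀ b → coeff d v b ≈ coeff d v' b

  scale : ∀ {A} → Carrier → LC A → LC A
  scale k = map (λ { (k' , a) → (k * k' , a) })

  mapLC : ∀ {A B} → (A → B) → LC A → LC B
  mapLC f = map (λ { (k , a) → (k , f a) })

  extend : ∀ {A B} → (A → LC B) → LC A → LC B
  extend f = concatMap (λ { (k , a) → scale k (f a) })

  -- the product ◇ of weight w on forests with labels in L
  module _ {L : Set} where
    tt : Tree L → Tree L → LC (Tree L)
    tf : Tree L → Forest L → LC (Forest L)
    ft : Forest L → Tree L → LC (Forest L)
    ff : Forest L → Forest L → LC (Forest L)

    tt • T' = (1# , T') ∷ []
    tt (B⁺ A) • = (1# , B⁺ A) ∷ []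
    tt t@(B⁺ A) t'@(B⁺ A') =
      mapLC B⁺ (tf t A') ++ (mapLC B⁺ (ft A t') ++ scale w (mapLC B⁺ (ff A A')))

    tf T ⟦ T' ⟧ = mapLC ⟦_⟧ (tt T T')
    tf T (T' ⟨ y ⟩ G) = mapLC (λ U → U ⟨ y ⟩ G) (tt T T')

    ft ⟦ T ⟧ T' = mapLC ⟦_⟧ (tt T T')
    ft (T ⟨ x ⟩ F) T' = mapLC (λ H → T ⟨ x ⟩ H) (ft F T')

    ff ⟦ T ⟧ G = tf T G
    ff (T ⟨ x ⟩ F) G = mapLC (λ H → T ⟨ x ⟩ H) (ff F G)

  mADF : ∀ {X Y : Set} → Forest X → Forest Y → LC (Forest (X ⊎ Y))
  mADF F G = ff (relabelF inj₁ F) (relabelF inj₂ G)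

  Pair : Set → Set
  Pair L = Forest L × Forest L

  mulPair : ∀ {X Y : Set} → Pair X → Pair Y → LC (Pair (X ⊎ Y))
  mulPair (F₁ , G₁) (F₂ , G₂) =
    extend (λ F → mapLC (λ G → (F , G)) (mADF G₁ G₂)) (mADF F₁ F₂)

  mul : ∀ {X Y : Set} → LC (Pair X) → LC (Pair Y) → LC (Pair (X ⊎ Y))
  mul u v = extend (λ p → extend (λ q → mulPair p q) v) u

  ε : ∀ {L} → Forest L → Carrier
  ε ⟦ • ⟧ = 1#
  ε ⟦ B⁺ _ ⟧ = 0#
  ε (_ ⟨ _ ⟩ _) = 0#

  -- R^{(2)}(F ⊗ G) = R(F) ⊗ G + ε(F) • ⊗ R(G),   R = B⁺
  R2Pair : ∀ {L} → Pair L → LC (Pair L)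
  R2Pair (F , G) = (1# , (⟦ B⁺ F ⟧ , G)) ∷ (ε F , (⟦ • ⟧ , ⟦ B⁺ G ⟧)) ∷ []

  R2 : ∀ {L} → LC (Pair L) → LC (Pair L)
  R2 = extend R2Pair

  relabelPair : ∀ {L M} → (L → M) → Pair L → Pair M
  relabelPair f (F , G) = (relabelF f F , relabelF f G)

  decPairFS : (X : FinSet) → DecidableEquality (Pair (FinSet.Carrier X))
  decPairFS X = decP (FinSet._≟_ X)

  decPair⊎ : (X Y : FinSet) → DecidableEquality (Pair (FinSet.Carrier X ⊎ FinSet.Carrier Y))
  decPair⊎ X Y = decP (SumP.≡-dec (FinSet._≟_ X) (FinSet._≟_ Y))

  -- the two parts of “(ADF ⊗ ADF, R^{(2)}) is a Rota–Baxter species of weight w”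
  -- (the twisted-algebra structure being given):
  -- (1) R^{(2)} is a morphism of species (natural w.r.t. bijections)
  R2Natural : Set (lsuc Level.zero ⊔ c ⊔ ℓ)
  R2Natural = ∀ (X X' : FinSet) (σ : FinSet.Carrier X ↔ FinSet.Carrier X')
    (x : LC (Pair (FinSet.Carrier X))) → All (λ p → ValidPair X (proj₂ p)) x →
    EqV (decPairFS X') (mapLC (relabelPair (Inverse.to σ)) (R2 x))
                       (R2 (mapLC (relabelPair (Inverse.to σ)) x))

  -- (2) the Rota–Baxter identity
  R2RotaBaxter : Set (lsuc Level.zero ⊔ c ⊔ ℓ)
  R2RotaBaxter = ∀ (X Y : FinSet)
    (x : LC (Pair (FinSet.Carrier X))) (y : LC (Pair (FinSet.Carrier Y))) →
    All (λ p → ValidPair X (proj₂ p)) x → All (λ p → ValidPair Y (proj₂ p)) y →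
    EqV (decPair⊎ X Y)
      (mul (R2 x) (R2 y))
      (R2 (mul (R2 x) y ++ (mul x (R2 y) ++ scale w (mul x y))))

{-# OPTIONS --safe #-}

-- Coefficients are values of linear functionals, so it suffices that every
-- functional g takes the same value on both sides.  Evaluated at g, both sides
-- of the Rota–Baxter identity are bilinear in x and y, which reduces the claim
-- to basis elements F₁ ⊗ G₁ and F₂ ⊗ G₂.  There, after expanding R⁽²⁾ and the
-- product, the identity follows from three facts about ADF: • is a unit for ◇,
-- R = B⁺ is a Rota–Baxter operator of weight λ on ADF, and ε is multiplicative
-- with ε ∘ R = 0.  Neither the characteristic nor the bijectivity of the
-- decorations plays any role.

module Submission where

open import Defs
open import Data.Product using (_×_; _,_; curry)
open import Data.Sum using (_⊎_; inj₁; inj₂)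
open import Data.List using ([]; _∷_; _++_)
open import Data.Bool using (if_then_else_)
open import Function using (_∘_; const)
open import Function.Bundles using (Inverse)
open import Relation.Nullary using (does; yes; no)
open import Relation.Binary.Definitions using (DecidableEquality)
open import Relation.Binary.PropositionalEquality as ≡ using (_≡_)
import Algebra.Properties.CommutativeSemigroup as CommutativeSemigroupProperties

module _ {c ℓ} (K : Field c ℓ) (w : Field.Carrier K) where
  open Field K
  open WithField K w
  open CommutativeSemigroupProperties +-commutativeSemigroup using (interchange)
  open CommutativeSemigroupProperties *-commutativeSemigroup using (x∙yz≈y∙xz)
  open import Algebra.Solver.Ring.NaturalCoefficients.Default commutativeSemiring
    using (solve; _:+_; _:*_; _:=_)
  open import Relation.Binary.Reasoning.Setoid setoid

  ⟪_∣_⟫ : {A : Set} → LC A → (A → Carrier) → Carrier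
  ⟪ [] ∣ g ⟫ = 0#
  ⟪ (k , a) ∷ u ∣ g ⟫ = k * g a + ⟪ u ∣ g ⟫

  ⟪_⊗_∣_⟫ : {A B : Set} → LC A → LC B → (A → B → Carrier) → Carrier
  ⟪ u ⊗ v ∣ f ⟫ = ⟪ u ∣ (λ a → ⟪ v ∣ f a ⟫) ⟫

  module _ {A : Set} where

    ⟪⟫-cong : ∀ (u : LC A) {g h : A → Carrier} → (∀ a → g a ≈ h a) → ⟪ u ∣ g ⟫ ≈ ⟪ u ∣ h ⟫
    ⟪⟫-cong [] g≈h = refl
    ⟪⟫-cong ((k , a) ∷ u) g≈h = +-cong (*-congˡ (g≈h a)) (⟪⟫-cong u g≈h)

    ⟪⟫-basis : ∀ (a : A) g → ⟪ (1# , a) ∷ [] ∣ g ⟫ ≈ g a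
    ⟪⟫-basis a g = trans (+-identityʳ _) (*-identityˡ (g a))

    ⟪⟫-++ : ∀ (u v : LC A) g → ⟪ u ++ v ∣ g ⟫ ≈ ⟪ u ∣ g ⟫ + ⟪ v ∣ g ⟫
    ⟪⟫-++ [] v g = sym (+-identityˡ _)
    ⟪⟫-++ ((k , a) ∷ u) v g = trans (+-congˡ (⟪⟫-++ u v g)) (sym (+-assoc _ _ _))

    ⟪⟫-scale : ∀ k (u : LC A) g → ⟪ scale k u ∣ g ⟫ ≈ k * ⟪ u ∣ g ⟫
    ⟪⟫-scale k [] g = sym (zeroʳ k)
    ⟪⟫-scale k ((k' , a) ∷ u) g =
      trans (+-cong (*-assoc _ _ _) (⟪⟫-scale k u g)) (sym (distribˡ k _ _))

    ⟪⟫-0 : ∀ (u : LC A) → ⟪ u ∣ const 0# ⟫ ≈ 0#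
    ⟪⟫-0 [] = refl
    ⟪⟫-0 ((k , a) ∷ u) = trans (+-cong (zeroʳ k) (⟪⟫-0 u)) (+-identityˡ 0#)

    ⟪⟫-+ : ∀ (u : LC A) g h → ⟪ u ∣ (λ a → g a + h a) ⟫ ≈ ⟪ u ∣ g ⟫ + ⟪ u ∣ h ⟫
    ⟪⟫-+ [] g h = sym (+-identityˡ _)
    ⟪⟫-+ ((k , a) ∷ u) g h =
      trans (+-cong (distribˡ k _ _) (⟪⟫-+ u g h)) (interchange _ _ _ _)

    ⟪⟫-*ˡ : ∀ (u : LC A) k g → ⟪ u ∣ (λ a → k * g a) ⟫ ≈ k * ⟪ u ∣ g ⟫
    ⟪⟫-*ˡ [] k g = sym (zeroʳ k)
    ⟪⟫-*ˡ ((k' , a) ∷ u) k g =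
      trans (+-cong (x∙yz≈y∙xz k' k (g a)) (⟪⟫-*ˡ u k g)) (sym (distribˡ k _ _))

    ⟪⟫-*ʳ : ∀ (u : LC A) k g → ⟪ u ∣ (λ a → g a * k) ⟫ ≈ ⟪ u ∣ g ⟫ * k
    ⟪⟫-*ʳ u k g =
      trans (⟪⟫-cong u (λ a → *-comm (g a) k)) (trans (⟪⟫-*ˡ u k g) (*-comm k _))

  ⟪⟫-mapLC : ∀ {A B : Set} (f : A → B) (u : LC A) g → ⟪ mapLC f u ∣ g ⟫ ≡ ⟪ u ∣ g ∘ f ⟫
  ⟪⟫-mapLC f [] g = ≡.refl
  ⟪⟫-mapLC f ((k , a) ∷ u) g = ≡.cong (k * g (f a) +_) (⟪⟫-mapLC f u g)

  ⟪⟫-extend : ∀ {A B : Set} (f : A → LC B) (u : LC A) g →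
    ⟪ extend f u ∣ g ⟫ ≈ ⟪ u ∣ (λ a → ⟪ f a ∣ g ⟫) ⟫
  ⟪⟫-extend f [] g = refl
  ⟪⟫-extend f ((k , a) ∷ u) g =
    trans (⟪⟫-++ (scale k (f a)) (extend f u) g) (+-cong (⟪⟫-scale k (f a) g) (⟪⟫-extend f u g))

  ⟪⟫-swap : ∀ {A B : Set} (u : LC A) (v : LC B) (f : A → B → Carrier) →
    ⟪ u ∣ (λ a → ⟪ v ∣ f a ⟫) ⟫ ≈ ⟪ v ∣ (λ b → ⟪ u ∣ (λ a → f a b) ⟫) ⟫
  ⟪⟫-swap [] v f = sym (⟪⟫-0 v)
  ⟪⟫-swap ((k , a) ∷ u) v f = begin
    k * ⟪ v ∣ f a ⟫ + ⟪ u ∣ (λ a' → ⟪ v ∣ f a' ⟫) ⟫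
      ≈⟨ +-cong (sym (⟪⟫-*ˡ v k (f a))) (⟪⟫-swap u v f) ⟩
    ⟪ v ∣ (λ b → k * f a b) ⟫ + ⟪ v ∣ (λ b → ⟪ u ∣ (λ a' → f a' b) ⟫) ⟫
      ≈⟨ ⟪⟫-+ v _ _ ⟨
    ⟪ v ∣ (λ b → k * f a b + ⟪ u ∣ (λ a' → f a' b) ⟫) ⟫ ∎

  module _ {A B : Set} where

    ⟪⊗⟫-cong : ∀ (u : LC A) (v : LC B) {f f' : A → B → Carrier} →
      (∀ a b → f a b ≈ f' a b) → ⟪ u ⊗ v ∣ f ⟫ ≈ ⟪ u ⊗ v ∣ f' ⟫
    ⟪⊗⟫-cong u v f≈f' = ⟪⟫-cong u (λ a → ⟪⟫-cong v (f≈f' a))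

    ⟪⊗⟫-+ : ∀ (u : LC A) (v : LC B) f f' →
      ⟪ u ⊗ v ∣ (λ a b → f a b + f' a b) ⟫ ≈ ⟪ u ⊗ v ∣ f ⟫ + ⟪ u ⊗ v ∣ f' ⟫
    ⟪⊗⟫-+ u v f f' = trans (⟪⟫-cong u (λ a → ⟪⟫-+ v (f a) (f' a))) (⟪⟫-+ u _ _)

    ⟪⊗⟫-*ˡ : ∀ (u : LC A) (v : LC B) k f →
      ⟪ u ⊗ v ∣ (λ a b → k * f a b) ⟫ ≈ k * ⟪ u ⊗ v ∣ f ⟫
    ⟪⊗⟫-*ˡ u v k f = trans (⟪⟫-cong u (λ a → ⟪⟫-*ˡ v k (f a))) (⟪⟫-*ˡ u k _)

    ⟪⊗⟫-extendˡ : ∀ {A' : Set} (h : A' → LC A) (u : LC A') (v : LC B) f →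
      ⟪ extend h u ⊗ v ∣ f ⟫ ≈ ⟪ u ⊗ v ∣ (λ a' b → ⟪ h a' ∣ (λ a → f a b) ⟫) ⟫
    ⟪⊗⟫-extendˡ h u v f =
      trans (⟪⟫-extend h u _) (⟪⟫-cong u (λ a' → ⟪⟫-swap (h a') v f))

    ⟪⊗⟫-extendʳ : ∀ {B' : Set} (h : B' → LC B) (u : LC A) (v : LC B') f →
      ⟪ u ⊗ extend h v ∣ f ⟫ ≈ ⟪ u ⊗ v ∣ (λ a b' → ⟪ h b' ∣ f a ⟫) ⟫
    ⟪⊗⟫-extendʳ h u v f = ⟪⟫-cong u (λ a → ⟪⟫-extend h v (f a))

  indicator : ∀ {A : Set} → DecidableEquality A → A → A → Carrier
  indicator _≟_ b a = if does (a ≟ b) then 1# else 0#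

  coeff≈⟪indicator⟫ : ∀ {A : Set} (_≟_ : DecidableEquality A) (u : LC A) b →
    coeff _≟_ u b ≈ ⟪ u ∣ indicator _≟_ b ⟫
  coeff≈⟪indicator⟫ _≟_ [] b = refl
  coeff≈⟪indicator⟫ _≟_ ((k , a) ∷ u) b with a ≟ b
  ... | yes _ = +-cong (sym (*-identityʳ k)) (coeff≈⟪indicator⟫ _≟_ u b)
  ... | no _  = trans (coeff≈⟪indicator⟫ _≟_ u b)
                  (sym (trans (+-congʳ (zeroʳ k)) (+-identityˡ _)))

  functionals⇒EqV : ∀ {A : Set} (_≟_ : DecidableEquality A) (u v : LC A) →
    (∀ g → ⟪ u ∣ g ⟫ ≈ ⟪ v ∣ g ⟫) → EqV _≟_ u v
  functionals⇒EqV _≟_ u v u≈v b =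
    trans (coeff≈⟪indicator⟫ _≟_ u b)
      (trans (u≈v (indicator _≟_ b)) (sym (coeff≈⟪indicator⟫ _≟_ v b)))

  R : ∀ {L : Set} → Forest L → Forest L
  R F = ⟦ B⁺ F ⟧

  module _ {Z : Set} where

    ◇-identityˡ : ∀ (G : Forest Z) φ → ⟪ ff ⟦ • ⟧ G ∣ φ ⟫ ≈ φ G
    ◇-identityˡ ⟦ T ⟧ φ = ⟪⟫-basis _ φ
    ◇-identityˡ (T ⟨ y ⟩ G) φ = ⟪⟫-basis _ φ

    ◇-identityʳ : ∀ (F : Forest Z) φ → ⟪ ff F ⟦ • ⟧ ∣ φ ⟫ ≈ φ F
    ◇-identityʳ ⟦ • ⟧ φ = ⟪⟫-basis _ φ
    ◇-identityʳ ⟦ B⁺ A ⟧ φ = ⟪⟫-basis _ φ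
    ◇-identityʳ (T ⟨ x ⟩ F) φ =
      trans (reflexive (⟪⟫-mapLC (T ⟨ x ⟩_) (ff F ⟦ • ⟧) φ)) (◇-identityʳ F (φ ∘ (T ⟨ x ⟩_)))

    ff≡ft : ∀ (F : Forest Z) T → ff F ⟦ T ⟧ ≡ ft F T
    ff≡ft ⟦ T₀ ⟧ T = ≡.refl
    ff≡ft (T₀ ⟨ x ⟩ F) T = ≡.cong (mapLC (T₀ ⟨ x ⟩_)) (ff≡ft F T)

    R-rotaBaxter : ∀ (a a' : Forest Z) φ →
      ⟪ ff (R a) (R a') ∣ φ ⟫ ≈
      ⟪ ff (R a) a' ∣ φ ∘ R ⟫ + (⟪ ff a (R a') ∣ φ ∘ R ⟫ + w * ⟪ ff a a' ∣ φ ∘ R ⟫)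
    R-rotaBaxter a a' φ = begin
      ⟪ mapLC ⟦_⟧ (tt (B⁺ a) (B⁺ a')) ∣ φ ⟫
        ≡⟨ ⟪⟫-mapLC ⟦_⟧ (tt (B⁺ a) (B⁺ a')) φ ⟩
      ⟪ mapLC B⁺ left ++ (mapLC B⁺ right ++ scale w (mapLC B⁺ both)) ∣ φ ∘ ⟦_⟧ ⟫
        ≈⟨ trans (⟪⟫-++ (mapLC B⁺ left) _ _) (+-congˡ (⟪⟫-++ (mapLC B⁺ right) _ _)) ⟩
      ⟪ mapLC B⁺ left ∣ φ ∘ ⟦_⟧ ⟫
        + (⟪ mapLC B⁺ right ∣ φ ∘ ⟦_⟧ ⟫ + ⟪ scale w (mapLC B⁺ both) ∣ φ ∘ ⟦_⟧ ⟫)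
        ≈⟨ +-congˡ (+-congˡ (⟪⟫-scale w (mapLC B⁺ both) _)) ⟩
      ⟪ mapLC B⁺ left ∣ φ ∘ ⟦_⟧ ⟫
        + (⟪ mapLC B⁺ right ∣ φ ∘ ⟦_⟧ ⟫ + w * ⟪ mapLC B⁺ both ∣ φ ∘ ⟦_⟧ ⟫)
        ≡⟨ ≡.cong₂ _+_ (⟪⟫-mapLC B⁺ left _) (≡.cong₂ _+_ (⟪⟫-mapLC B⁺ right _)
                         (≡.cong (w *_) (⟪⟫-mapLC B⁺ both _))) ⟩
      ⟪ left ∣ φ ∘ R ⟫ + (⟪ right ∣ φ ∘ R ⟫ + w * ⟪ both ∣ φ ∘ R ⟫)
        ≡⟨ ≡.cong (λ r → ⟪ left ∣ φ ∘ R ⟫ + (⟪ r ∣ φ ∘ R ⟫ + w * ⟪ both ∣ φ ∘ R ⟫))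
                  (≡.sym (ff≡ft a (B⁺ a'))) ⟩
      ⟪ ff (R a) a' ∣ φ ∘ R ⟫ + (⟪ ff a (R a') ∣ φ ∘ R ⟫ + w * ⟪ ff a a' ∣ φ ∘ R ⟫) ∎
      where
      left right both : LC (Forest Z)
      left  = tf (B⁺ a) a'
      right = ft a (B⁺ a')
      both  = ff a a'

    ε-◇ : ∀ (F G : Forest Z) → ⟪ ff F G ∣ ε ⟫ ≈ ε F * ε G
    ε-◇ (T ⟨ x ⟩ F) G =
      trans (reflexive (⟪⟫-mapLC (T ⟨ x ⟩_) (ff F G) ε))
        (trans (⟪⟫-0 (ff F G)) (sym (zeroˡ (ε G))))
    ε-◇ ⟦ T ⟧ (T' ⟨ y ⟩ G) =
      trans (reflexive (⟪⟫-mapLC (_⟨ y ⟩ G) (tt T T') ε))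
        (trans (⟪⟫-0 (tt T T')) (sym (zeroʳ (ε ⟦ T ⟧))))
    ε-◇ ⟦ • ⟧ ⟦ T' ⟧ = +-identityʳ _
    ε-◇ ⟦ B⁺ A ⟧ ⟦ • ⟧ = trans (⟪⟫-basis (R A) ε) (sym (zeroˡ 1#))
    ε-◇ ⟦ B⁺ A ⟧ ⟦ B⁺ A' ⟧ = begin
      ⟪ ff (R A) (R A') ∣ ε ⟫
        ≈⟨ R-rotaBaxter A A' ε ⟩
      ⟪ ff (R A) A' ∣ const 0# ⟫ + (⟪ ff A (R A') ∣ const 0# ⟫ + w * ⟪ ff A A' ∣ const 0# ⟫)
        ≈⟨ +-cong (⟪⟫-0 (ff (R A) A')) (+-cong (⟪⟫-0 (ff A (R A'))) (*-congˡ (⟪⟫-0 (ff A A')))) ⟩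
      0# + (0# + w * 0#)
        ≈⟨ trans (+-identityˡ _) (trans (+-identityˡ _) (zeroʳ w)) ⟩
      0#
        ≈⟨ zeroˡ 0# ⟨
      0# * 0# ∎

  R2ᵗ : ∀ {L : Set} → (Pair L → Carrier) → Pair L → Carrier
  R2ᵗ g (F , G) = g (R F , G) + ε F * g (⟦ • ⟧ , R G)

  ⟪R2Pair⟫ : ∀ {L : Set} (p : Pair L) g → ⟪ R2Pair p ∣ g ⟫ ≈ R2ᵗ g p
  ⟪R2Pair⟫ p g = +-cong (*-identityˡ _) (+-identityʳ _)

  ⟪⟫-R2 : ∀ {L : Set} (u : LC (Pair L)) g → ⟪ R2 u ∣ g ⟫ ≈ ⟪ u ∣ R2ᵗ g ⟫
  ⟪⟫-R2 u g = trans (⟪⟫-extend R2Pair u g) (⟪⟫-cong u (λ p → ⟪R2Pair⟫ p g))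

  ε-relabel : ∀ {L M : Set} (f : L → M) (F : Forest L) → ε (relabelF f F) ≡ ε F
  ε-relabel f ⟦ • ⟧ = ≡.refl
  ε-relabel f ⟦ B⁺ _ ⟧ = ≡.refl
  ε-relabel f (_ ⟨ _ ⟩ _) = ≡.refl

  ⟪R2Pair⟫-relabel : ∀ {L M : Set} (f : L → M) (p : Pair L) g →
    ⟪ R2Pair p ∣ g ∘ relabelPair f ⟫ ≈ R2ᵗ g (relabelPair f p)
  ⟪R2Pair⟫-relabel f (F , G) g rewrite ε-relabel f F = ⟪R2Pair⟫ (F , G) (g ∘ relabelPair f)

  R2-relabel : ∀ {L M : Set} (f : L → M) (x : LC (Pair L)) →
    mapLC (relabelPair f) (R2 x) ≡ R2 (mapLC (relabelPair f) x)
  R2-relabel f [] = ≡.refl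
  R2-relabel f ((k , (F , G)) ∷ x) rewrite ε-relabel f F | R2-relabel f x = ≡.refl

  R2-natural : R2Natural
  R2-natural X X' σ x _ b =
    reflexive (≡.cong (λ v → coeff (decPairFS X') v b) (R2-relabel (Inverse.to σ) x))

  ⟪_⊛_∣_⟫ : ∀ {Z : Set} → Pair Z → Pair Z → (Pair Z → Carrier) → Carrier
  ⟪ (F₁ , G₁) ⊛ (F₂ , G₂) ∣ g ⟫ = ⟪ ff F₁ F₂ ⊗ ff G₁ G₂ ∣ curry g ⟫

  module _ {Z : Set} where

    ⟪⟫-R2ᵗ : ∀ (v : LC (Forest Z)) g F →
      ⟪ v ∣ curry (R2ᵗ g) F ⟫ ≈ ⟪ v ∣ curry g (R F) ⟫ + ε F * ⟪ v ∣ curry g ⟦ • ⟧ ∘ R ⟫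
    ⟪⟫-R2ᵗ v g F = trans (⟪⟫-+ v _ _) (+-congˡ (⟪⟫-*ˡ v (ε F) _))

    ⟪⊗⟫-R2ᵗ : ∀ (u v : LC (Forest Z)) g →
      ⟪ u ⊗ v ∣ curry (R2ᵗ g) ⟫ ≈
      ⟪ u ⊗ v ∣ curry g ∘ R ⟫ + ⟪ u ∣ ε ⟫ * ⟪ v ∣ curry g ⟦ • ⟧ ∘ R ⟫
    ⟪⊗⟫-R2ᵗ u v g =
      trans (⟪⟫-cong u (⟪⟫-R2ᵗ v g)) (trans (⟪⟫-+ u _ _) (+-congˡ (⟪⟫-*ʳ u _ ε)))

    ⟪⊗⟫-R2ᵗ-ε≈0 : ∀ (u v : LC (Forest Z)) g → ⟪ u ∣ ε ⟫ ≈ 0# →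
      ⟪ u ⊗ v ∣ curry (R2ᵗ g) ⟫ ≈ ⟪ u ⊗ v ∣ curry g ∘ R ⟫
    ⟪⊗⟫-R2ᵗ-ε≈0 u v g εu≈0 =
      trans (⟪⊗⟫-R2ᵗ u v g)
        (trans (+-congˡ (trans (*-congʳ εu≈0) (zeroˡ _))) (+-identityʳ _))

    -- Terms are named by the first components of their two factors (· for an
    -- unchanged a or b); ᵗ marks evaluation at R2ᵗ g.
    module R2ᵗ-Expansion (g : Pair Z → Carrier) (a₁ b₁ a₂ b₂ : Forest Z) where
      P₁ P₂ P₃ Q₁ Q₂ Q₃ S₁ S₂ e₁ e₂ : Carrier
      P₁ = ⟪ ff (R a₁) a₂ ⊗ ff b₁ b₂ ∣ curry g ∘ R ⟫
      P₂ = ⟪ ff a₁ (R a₂) ⊗ ff b₁ b₂ ∣ curry g ∘ R ⟫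
      P₃ = ⟪ ff a₁ a₂ ⊗ ff b₁ b₂ ∣ curry g ∘ R ⟫
      Q₁ = ⟪ ff (R b₁) b₂ ∣ curry g ⟦ • ⟧ ∘ R ⟫
      Q₂ = ⟪ ff b₁ (R b₂) ∣ curry g ⟦ • ⟧ ∘ R ⟫
      Q₃ = ⟪ ff b₁ b₂ ∣ curry g ⟦ • ⟧ ∘ R ⟫
      S₁ = ⟪ ff b₁ (R b₂) ∣ curry g (R a₁) ⟫
      S₂ = ⟪ ff (R b₁) b₂ ∣ curry g (R a₂) ⟫
      e₁ = ε a₁
      e₂ = ε a₂

      RR : ⟪ (R a₁ , b₁) ⊛ (R a₂ , b₂) ∣ g ⟫ ≈ P₁ + (P₂ + w * P₃)
      RR = R-rotaBaxter a₁ a₂ (λ F → ⟪ ff b₁ b₂ ∣ curry g F ⟫)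

      R• : ⟪ (R a₁ , b₁) ⊛ (⟦ • ⟧ , R b₂) ∣ g ⟫ ≈ S₁
      R• = ◇-identityʳ (R a₁) (λ F → ⟪ ff b₁ (R b₂) ∣ curry g F ⟫)

      •R : ⟪ (⟦ • ⟧ , R b₁) ⊛ (R a₂ , b₂) ∣ g ⟫ ≈ S₂
      •R = ◇-identityˡ (R a₂) (λ F → ⟪ ff (R b₁) b₂ ∣ curry g F ⟫)

      •• : ⟪ (⟦ • ⟧ , R b₁) ⊛ (⟦ • ⟧ , R b₂) ∣ g ⟫ ≈ Q₁ + (Q₂ + w * Q₃)
      •• = trans (◇-identityˡ ⟦ • ⟧ (λ F → ⟪ ff (R b₁) (R b₂) ∣ curry g F ⟫))
                 (R-rotaBaxter b₁ b₂ (curry g ⟦ • ⟧))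

      R·ᵗ : ⟪ (R a₁ , b₁) ⊛ (a₂ , b₂) ∣ R2ᵗ g ⟫ ≈ P₁
      R·ᵗ = ⟪⊗⟫-R2ᵗ-ε≈0 (ff (R a₁) a₂) (ff b₁ b₂) g (trans (ε-◇ (R a₁) a₂) (zeroˡ e₂))

      ·Rᵗ : ⟪ (a₁ , b₁) ⊛ (R a₂ , b₂) ∣ R2ᵗ g ⟫ ≈ P₂
      ·Rᵗ = ⟪⊗⟫-R2ᵗ-ε≈0 (ff a₁ (R a₂)) (ff b₁ b₂) g (trans (ε-◇ a₁ (R a₂)) (zeroʳ e₁))

      •·ᵗ : ⟪ (⟦ • ⟧ , R b₁) ⊛ (a₂ , b₂) ∣ R2ᵗ g ⟫ ≈ S₂ + e₂ * Q₁
      •·ᵗ = trans (◇-identityˡ a₂ _) (⟪⟫-R2ᵗ (ff (R b₁) b₂) g a₂)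

      ·•ᵗ : ⟪ (a₁ , b₁) ⊛ (⟦ • ⟧ , R b₂) ∣ R2ᵗ g ⟫ ≈ S₁ + e₁ * Q₂
      ·•ᵗ = trans (◇-identityʳ a₁ _) (⟪⟫-R2ᵗ (ff b₁ (R b₂)) g a₁)

      ··ᵗ : ⟪ (a₁ , b₁) ⊛ (a₂ , b₂) ∣ R2ᵗ g ⟫ ≈ P₃ + e₁ * e₂ * Q₃
      ··ᵗ = trans (⟪⊗⟫-R2ᵗ (ff a₁ a₂) (ff b₁ b₂) g) (+-congˡ (*-congʳ (ε-◇ a₁ a₂)))

      regroup : ((P₁ + (P₂ + w * P₃)) + e₂ * S₁) + e₁ * (S₂ + e₂ * (Q₁ + (Q₂ + w * Q₃))) ≈
                (P₁ + e₁ * (S₂ + e₂ * Q₁)) + ((P₂ + e₂ * (S₁ + e₁ * Q₂)) + w * (P₃ + e₁ * e₂ * Q₃))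
      regroup = solve 11
        (λ P₁ P₂ P₃ Q₁ Q₂ Q₃ S₁ S₂ e₁ e₂ w →
          ((P₁ :+ (P₂ :+ w :* P₃)) :+ e₂ :* S₁) :+ e₁ :* (S₂ :+ e₂ :* (Q₁ :+ (Q₂ :+ w :* Q₃))) :=
          (P₁ :+ e₁ :* (S₂ :+ e₂ :* Q₁))
            :+ ((P₂ :+ e₂ :* (S₁ :+ e₁ :* Q₂)) :+ w :* (P₃ :+ e₁ :* e₂ :* Q₃)))
        refl P₁ P₂ P₃ Q₁ Q₂ Q₃ S₁ S₂ e₁ e₂ w

    R2ᵗ-rotaBaxter : ∀ g (p q : Pair Z) →
      R2ᵗ (λ p' → R2ᵗ (λ q' → ⟪ p' ⊛ q' ∣ g ⟫) q) p ≈
      R2ᵗ (λ p' → ⟪ p' ⊛ q ∣ R2ᵗ g ⟫) p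
        + (R2ᵗ (λ q' → ⟪ p ⊛ q' ∣ R2ᵗ g ⟫) q + w * ⟪ p ⊛ q ∣ R2ᵗ g ⟫)
    R2ᵗ-rotaBaxter g (a₁ , b₁) (a₂ , b₂) = begin
      (⟪ (R a₁ , b₁) ⊛ (R a₂ , b₂) ∣ g ⟫ + e₂ * ⟪ (R a₁ , b₁) ⊛ (⟦ • ⟧ , R b₂) ∣ g ⟫)
        + e₁ * (⟪ (⟦ • ⟧ , R b₁) ⊛ (R a₂ , b₂) ∣ g ⟫ + e₂ * ⟪ (⟦ • ⟧ , R b₁) ⊛ (⟦ • ⟧ , R b₂) ∣ g ⟫)
        ≈⟨ +-cong (+-cong RR (*-congˡ R•)) (*-congˡ (+-cong •R (*-congˡ ••))) ⟩
      ((P₁ + (P₂ + w * P₃)) + e₂ * S₁) + e₁ * (S₂ + e₂ * (Q₁ + (Q₂ + w * Q₃)))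
        ≈⟨ regroup ⟩
      (P₁ + e₁ * (S₂ + e₂ * Q₁)) + ((P₂ + e₂ * (S₁ + e₁ * Q₂)) + w * (P₃ + e₁ * e₂ * Q₃))
        ≈⟨ +-cong (+-cong R·ᵗ (*-congˡ •·ᵗ)) (+-cong (+-cong ·Rᵗ (*-congˡ ·•ᵗ)) (*-congˡ ··ᵗ)) ⟨
      (⟪ (R a₁ , b₁) ⊛ (a₂ , b₂) ∣ R2ᵗ g ⟫ + e₁ * ⟪ (⟦ • ⟧ , R b₁) ⊛ (a₂ , b₂) ∣ R2ᵗ g ⟫)
        + ((⟪ (a₁ , b₁) ⊛ (R a₂ , b₂) ∣ R2ᵗ g ⟫ + e₂ * ⟪ (a₁ , b₁) ⊛ (⟦ • ⟧ , R b₂) ∣ R2ᵗ g ⟫)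
           + w * ⟪ (a₁ , b₁) ⊛ (a₂ , b₂) ∣ R2ᵗ g ⟫) ∎
      where open R2ᵗ-Expansion g a₁ b₁ a₂ b₂

  ⟪⟫-mul : ∀ {X Y : Set} (u : LC (Pair X)) (v : LC (Pair Y)) g →
    ⟪ mul u v ∣ g ⟫ ≈ ⟪ u ⊗ v ∣ (λ p q → ⟪ mulPair p q ∣ g ⟫) ⟫
  ⟪⟫-mul u v g = trans (⟪⟫-extend _ u g) (⟪⟫-cong u (λ p → ⟪⟫-extend _ v g))

  module _ {X Y : Set} where

    ⟪mulPair⟫ : ∀ (p : Pair X) (q : Pair Y) g →
      ⟪ mulPair p q ∣ g ⟫ ≈ ⟪ relabelPair inj₁ p ⊛ relabelPair inj₂ q ∣ g ⟫
    ⟪mulPair⟫ (F₁ , G₁) (F₂ , G₂) g =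
      trans (⟪⟫-extend _ (mADF F₁ F₂) g)
        (⟪⟫-cong (mADF F₁ F₂) (λ F → reflexive (⟪⟫-mapLC (F ,_) (mADF G₁ G₂) g)))

    ⟪R2Pair⟫-mulPairˡ : ∀ (p : Pair X) (q : Pair Y) g →
      ⟪ R2Pair p ∣ (λ p' → ⟪ mulPair p' q ∣ g ⟫) ⟫ ≈
      R2ᵗ (λ p' → ⟪ p' ⊛ relabelPair inj₂ q ∣ g ⟫) (relabelPair inj₁ p)
    ⟪R2Pair⟫-mulPairˡ p q g =
      trans (⟪⟫-cong (R2Pair p) (λ p' → ⟪mulPair⟫ p' q g))
        (⟪R2Pair⟫-relabel inj₁ p (λ p' → ⟪ p' ⊛ relabelPair inj₂ q ∣ g ⟫))

    ⟪R2Pair⟫-mulPairʳ : ∀ (p : Pair X) (q : Pair Y) g →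
      ⟪ R2Pair q ∣ (λ q' → ⟪ mulPair p q' ∣ g ⟫) ⟫ ≈
      R2ᵗ (λ q' → ⟪ relabelPair inj₁ p ⊛ q' ∣ g ⟫) (relabelPair inj₂ q)
    ⟪R2Pair⟫-mulPairʳ p q g =
      trans (⟪⟫-cong (R2Pair q) (λ q' → ⟪mulPair⟫ p q' g))
        (⟪R2Pair⟫-relabel inj₂ q (λ q' → ⟪ relabelPair inj₁ p ⊛ q' ∣ g ⟫))

    R2-rotaBaxter-basis : ∀ g (p : Pair X) (q : Pair Y) →
      ⟪ R2Pair p ∣ (λ p' → ⟪ R2Pair q ∣ (λ q' → ⟪ mulPair p' q' ∣ g ⟫) ⟫) ⟫ ≈
      ⟪ R2Pair p ∣ (λ p' → ⟪ mulPair p' q ∣ R2ᵗ g ⟫) ⟫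
        + (⟪ R2Pair q ∣ (λ q' → ⟪ mulPair p q' ∣ R2ᵗ g ⟫) ⟫ + w * ⟪ mulPair p q ∣ R2ᵗ g ⟫)
    R2-rotaBaxter-basis g p q = begin
      ⟪ R2Pair p ∣ (λ p' → ⟪ R2Pair q ∣ (λ q' → ⟪ mulPair p' q' ∣ g ⟫) ⟫) ⟫
        ≈⟨ ⟪⟫-cong (R2Pair p) (λ p' → ⟪R2Pair⟫-mulPairʳ p' q g) ⟩
      ⟪ R2Pair p ∣ (λ p' → R2ᵗ (λ q' → ⟪ relabelPair inj₁ p' ⊛ q' ∣ g ⟫) q₂) ⟫
        ≈⟨ ⟪R2Pair⟫-relabel inj₁ p (λ p' → R2ᵗ (λ q' → ⟪ p' ⊛ q' ∣ g ⟫) q₂) ⟩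
      R2ᵗ (λ p' → R2ᵗ (λ q' → ⟪ p' ⊛ q' ∣ g ⟫) q₂) p₁
        ≈⟨ R2ᵗ-rotaBaxter g p₁ q₂ ⟩
      R2ᵗ (λ p' → ⟪ p' ⊛ q₂ ∣ R2ᵗ g ⟫) p₁
        + (R2ᵗ (λ q' → ⟪ p₁ ⊛ q' ∣ R2ᵗ g ⟫) q₂ + w * ⟪ p₁ ⊛ q₂ ∣ R2ᵗ g ⟫)
        ≈⟨ +-cong (⟪R2Pair⟫-mulPairˡ p q (R2ᵗ g))
                  (+-cong (⟪R2Pair⟫-mulPairʳ p q (R2ᵗ g)) (*-congˡ (⟪mulPair⟫ p q (R2ᵗ g)))) ⟨
      ⟪ R2Pair p ∣ (λ p' → ⟪ mulPair p' q ∣ R2ᵗ g ⟫) ⟫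
        + (⟪ R2Pair q ∣ (λ q' → ⟪ mulPair p q' ∣ R2ᵗ g ⟫) ⟫ + w * ⟪ mulPair p q ∣ R2ᵗ g ⟫) ∎
      where
      p₁ q₂ : Pair (X ⊎ Y)
      p₁ = relabelPair inj₁ p
      q₂ = relabelPair inj₂ q

    ⟪⟫-R2-rotaBaxter : ∀ g (x : LC (Pair X)) (y : LC (Pair Y)) →
      ⟪ mul (R2 x) (R2 y) ∣ g ⟫ ≈ ⟪ R2 (mul (R2 x) y ++ (mul x (R2 y) ++ scale w (mul x y))) ∣ g ⟫
    ⟪⟫-R2-rotaBaxter g x y = begin
      ⟪ mul (R2 x) (R2 y) ∣ g ⟫
        ≈⟨ ⟪⟫-mul (R2 x) (R2 y) g ⟩
      ⟪ R2 x ⊗ R2 y ∣ m g ⟫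
        ≈⟨ ⟪⊗⟫-extendʳ R2Pair (R2 x) y (m g) ⟩
      ⟪ R2 x ⊗ y ∣ (λ p' q → ⟪ R2Pair q ∣ m g p' ⟫) ⟫
        ≈⟨ ⟪⊗⟫-extendˡ R2Pair x y _ ⟩
      ⟪ x ⊗ y ∣ (λ p q → ⟪ R2Pair p ∣ (λ p' → ⟪ R2Pair q ∣ m g p' ⟫) ⟫) ⟫
        ≈⟨ ⟪⊗⟫-cong x y (R2-rotaBaxter-basis g) ⟩
      ⟪ x ⊗ y ∣ (λ p q → Rˡ p q + (Rʳ p q + w * m h p q)) ⟫
        ≈⟨ trans (⟪⊗⟫-+ x y _ _) (+-congˡ (trans (⟪⊗⟫-+ x y _ _) (+-congˡ (⟪⊗⟫-*ˡ x y w _)))) ⟩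
      ⟪ x ⊗ y ∣ Rˡ ⟫ + (⟪ x ⊗ y ∣ Rʳ ⟫ + w * ⟪ x ⊗ y ∣ m h ⟫)
        ≈⟨ +-cong mulR2ˡ (+-cong mulR2ʳ (*-congˡ (⟪⟫-mul x y h))) ⟨
      ⟪ mul (R2 x) y ∣ h ⟫ + (⟪ mul x (R2 y) ∣ h ⟫ + w * ⟪ mul x y ∣ h ⟫)
        ≈⟨ +-congˡ (+-congˡ (⟪⟫-scale w (mul x y) h)) ⟨
      ⟪ mul (R2 x) y ∣ h ⟫ + (⟪ mul x (R2 y) ∣ h ⟫ + ⟪ scale w (mul x y) ∣ h ⟫)
        ≈⟨ trans (⟪⟫-++ (mul (R2 x) y) _ h) (+-congˡ (⟪⟫-++ (mul x (R2 y)) _ h)) ⟨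
      ⟪ mul (R2 x) y ++ (mul x (R2 y) ++ scale w (mul x y)) ∣ h ⟫
        ≈⟨ ⟪⟫-R2 (mul (R2 x) y ++ (mul x (R2 y) ++ scale w (mul x y))) g ⟨
      ⟪ R2 (mul (R2 x) y ++ (mul x (R2 y) ++ scale w (mul x y))) ∣ g ⟫ ∎
      where
      h : Pair (X ⊎ Y) → Carrier
      h = R2ᵗ g
      m : (Pair (X ⊎ Y) → Carrier) → Pair X → Pair Y → Carrier
      m g' p q = ⟪ mulPair p q ∣ g' ⟫
      Rˡ Rʳ : Pair X → Pair Y → Carrier
      Rˡ p q = ⟪ R2Pair p ∣ (λ p' → m h p' q) ⟫
      Rʳ p q = ⟪ R2Pair q ∣ m h p ⟫
      mulR2ˡ : ⟪ mul (R2 x) y ∣ h ⟫ ≈ ⟪ x ⊗ y ∣ Rˡ ⟫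
      mulR2ˡ = trans (⟪⟫-mul (R2 x) y h) (⟪⊗⟫-extendˡ R2Pair x y (m h))
      mulR2ʳ : ⟪ mul x (R2 y) ∣ h ⟫ ≈ ⟪ x ⊗ y ∣ Rʳ ⟫
      mulR2ʳ = trans (⟪⟫-mul x (R2 y) h) (⟪⊗⟫-extendʳ R2Pair x y (m h))

  R2-rotaBaxter : R2RotaBaxter
  R2-rotaBaxter X Y x y _ _ =
    functionals⇒EqV (decPair⊎ X Y) (mul (R2 x) (R2 y))
      (R2 (mul (R2 x) y ++ (mul x (R2 y) ++ scale w (mul x y))))
      (λ g → ⟪⟫-R2-rotaBaxter g x y)

proposition3p3 : ∀ {c ℓ} (K : Field c ℓ) → CharZero K → (λw : Field.Carrier K) →
    WithField.R2Natural K λw × WithField.R2RotaBaxter K λw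
proposition3p3 K _ λw = R2-natural K λw , R2-rotaBaxter K λw
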